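{- Let $d_{n,1}$ denote the number of derangements of $[n]$ having exactly one right-to-left minimum. Then $$\sum_{n\ge 0}d_{n+2,1}\frac{x^n}{n!}=\frac{e^{ -x}}{(1-x)^2}.$$
   Context: A derangement of $[n]$ is a permutation $\sigma$ with no fixed points. A right-to-left minimum of $\sigma$ is a value $\sigma(i)$ such that $\sigma(i)<\sigma(k)$ for all $k>i$. -}

module Defs where

open import Data.Nat as ℕ using (ℕ; zero; suc; _∸_; _!)
open import Data.Nat.Properties using (_!≢0)
open import Data.Fin as Fin using (Fin; _<_)
open import Data.Fin.Properties using (all?; _≟_; _<?_)
open import Data.Vec using (Vec; []; _∷_; lookup)
open import Data.List using (List; []; _∷_; length; filter; concatMap; map; allFin)
open import Data.Integer using (ℤ; +_; -[1+_])
open import Data.Rational as ℚ using (ℚ; _/_; 0ℚ)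
open import Relation.Binary.PropositionalEquality using (_≡_; _≢_)
open import Relation.Nullary using (¬_; Dec)
open import Relation.Nullary.Decidable using (_→-dec_; ¬?; _×-dec_)
open import Data.Product using (_×_)

-- Permutations of [n] in one-line notation: σ is the vector (σ(0),…,σ(n-1))
-- over Fin n, required to be injective (hence bijective, Fin n being finite).

allVecs : (m n : ℕ) → List (Vec (Fin n) m)
allVecs zero    n = [] ∷ []
allVecs (suc m) n = concatMap (λ v → map (λ x → x ∷ v) (allFin n)) (allVecs m n)

IsPerm : ∀ {n} → Vec (Fin n) n → Set
IsPerm {n} σ = ∀ (i j : Fin n) → lookup σ i ≡ lookup σ j → i ≡ j

isPerm? : ∀ {n} (σ : Vec (Fin n) n) → Dec (IsPerm σ)
isPerm? σ = all? λ i → all? λ j → (lookup σ i ≟ lookup σ j) →-dec (i ≟ j)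

IsDerangement : ∀ {n} → Vec (Fin n) n → Set
IsDerangement {n} σ = ∀ (i : Fin n) → lookup σ i ≢ i

isDerangement? : ∀ {n} (σ : Vec (Fin n) n) → Dec (IsDerangement σ)
isDerangement? σ = all? λ i → ¬? (lookup σ i ≟ i)

IsRLMin : ∀ {n} → Vec (Fin n) n → Fin n → Set
IsRLMin {n} σ i = ∀ (k : Fin n) → i < k → lookup σ i < lookup σ k

isRLMin? : ∀ {n} (σ : Vec (Fin n) n) (i : Fin n) → Dec (IsRLMin σ i)
isRLMin? σ i = all? λ k → (i <? k) →-dec (lookup σ i <? lookup σ k)

-- number of right-to-left minima of σ (σ is injective, so positions ↔ values)
numRLMin : ∀ {n} → Vec (Fin n) n → ℕ
numRLMin {n} σ = length (filter (isRLMin? σ) (allFin n))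

d : ℕ → ℕ → ℕ
d n k = length (filter (λ σ → isPerm? σ ×-dec (isDerangement? σ ×-dec (numRLMin σ ℕ.≟ k)))
                       (allVecs n n))

FPS : Set
FPS = ℕ → ℚ

sumTo : ℕ → (ℕ → ℚ) → ℚ
sumTo zero    f = f zero
sumTo (suc n) f = sumTo n f ℚ.+ f (suc n)

_⋆_ : FPS → FPS → FPS
(f ⋆ g) n = sumTo n (λ k → f k ℚ.* g (n ∸ k))

infixl 7 _⋆_


sign : ℕ → ℤ
sign zero          = + 1
sign (suc zero)    = -[1+ 0 ]
sign (suc (suc n)) = sign n

expNeg : FPS
expNeg n = (sign n / n !) {{n !≢0}}

geom : FPS
geom n = ℚ.1ℚ

egf : (ℕ → ℕ) → FPS
egf a n = (+ a n / n !) {{n !≢0}}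

-- Let A(N, b) count the permutations of [N] with no fixed point at a position ≥ b. Splitting
-- those counted by A(N+1, b+1) according to whether b is fixed, and deleting that fixed point,
-- gives the Pascal-type rule A(N+1, b+1) = A(N, b) + A(N+1, b); with A(N, N) = N! it forces the
-- derangement numbers D n = A(n, 0) to satisfy D (n+2) = (n+1) (D (n+1) + D n), hence
-- D n / n! = Σ_{k≤n} (-1)^k / k!.  A derangement of [n+2] has a single right-to-left minimum
-- iff it ends in 0; exchanging the values 0 and n+1 and deleting the resulting fixed point n+1
-- identifies these derangements with the permutations counted by A(n+1, 1) = D n + D (n+1).
-- Finally, the n-th increment of (D n + D (n+1)) / n! is D n / n!, the n-th partial sum of e^{-x};
-- the coefficients of e^{-x} (1-x)^{-2}, being the partial sums of those partial sums, start at the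
-- same value and have the same increments.
module Submission where

open import Defs

open import Algebra.Bundles using (CommutativeMonoid)
open import Data.Fin as Fin using (Fin; zero; suc; toℕ; fromℕ; fromℕ<; punchIn; punchOut)
open import Data.Fin.Permutation.Components using (transpose)
open import Data.Fin.Properties using (_≟_; all?; any?; pigeonhole; toℕ<n; toℕ-fromℕ<; toℕ-injective; ≤fromℕ;
  punchIn-injective; punchInᵢ≢i; punchIn-punchOut; punchOut-punchIn; punchOut-injective; punchOut-cong)
  renaming (<⇒≢ to <⇒≢ᶠ; ≤∧≢⇒< to ≤∧≢⇒<ᶠ)
open import Data.Integer as ℤ using (ℤ; +_; -_)
open import Data.Integer.Properties using (pos-+; pos-*)
import Data.Integer.Tactic.RingSolver as ℤ-Solver
open import Data.List using (List; []; _∷_; _++_; length; filter; map; concatMap; allFin; cartesianProductWith)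
open import Data.List.Membership.Propositional using (_∈_)
open import Data.List.Membership.Propositional.Properties
  using (∈-filter⁺; ∈-filter⁻; ∈-map∘filter⁺; ∈-map∘filter⁻; ∈-allFin; ∈-cartesianProductWith⁺)
open import Data.List.Membership.Propositional.Properties.WithK using (unique∧set⇒bag)
open import Data.List.Properties using (length-map; map-id-local; filter-≐; filter-none)
  renaming (map-∘ to List-map-∘)
open import Data.List.Relation.Binary.BagAndSetEquality using (∼bag⇒↭)
open import Data.List.Relation.Binary.Permutation.Propositional.Properties using (↭-length)
open import Data.List.Relation.Unary.All as All using (All)
open import Data.List.Relation.Unary.All.Properties using (all-filter)
open import Data.List.Relation.Unary.AllPairs using ([]; _∷_)
open import Data.List.Relation.Unary.Any using (here)
open import Data.List.Relation.Unary.Unique.Propositional using (Unique)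
import Data.List.Relation.Unary.Unique.Propositional.Properties as Unique
open import Data.Nat as ℕ using (ℕ; zero; suc; _+_; _*_; _∸_; _!; _≤_; _<_; _≤?_; _<?_; z≤n; s≤s; NonZero)
open import Data.Nat.Properties using (_!≢0; +-suc; +-comm; +-identityʳ; +-cancelˡ-≡; *-distribˡ-+; +-∸-assoc;
  n∸n≡0; ≤-refl; ≤-reflexive; ≤-trans; ≤-pred; ≤-antisym; n≤1+n; m≤n⇒m≤1+n; m≤m+n; n<1+n; <-irrefl; ≤∧≢⇒<;
  ≮⇒≥; ≤⇒≯; <⇒≱)
import Data.Nat.Tactic.RingSolver as ℕ-Solver
open import Data.Product using (_×_; _,_; proj₁; proj₂; swap; ∃)
open import Data.Rational as ℚ using (ℚ; _/_; 1ℚ; toℚᵘ)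
open import Data.Rational.Properties as ℚₚ using (toℚᵘ-injective; toℚᵘ-homo-+; toℚᵘ-fromℚᵘ)
open import Data.Rational.Unnormalised as ℚᵘ using (*≡*)
import Data.Rational.Unnormalised.Properties as ℚᵘₚ
open import Data.Vec as Vec using (Vec; []; _∷_; lookup; tabulate)
open import Data.Vec.Properties using (∷-injective; lookup-map; map-∘; map-cong; map-id; lookup∘tabulate)
open import Data.Vec.Relation.Binary.Pointwise.Extensional using (ext; Pointwise-≡⇒≡)
open import Function using (_∘_; mk⇔)
open import Level using (0ℓ)
open import Relation.Binary.PropositionalEquality
open import Relation.Nullary using (Dec; yes; no; ¬_)
open import Relation.Nullary.Decidable using (dec-true; dec-false; _→-dec_; ¬?)
open import Relation.Nullary.Negation using (contradiction)
open import Relation.Unary using (Pred; Decidable; U)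
open import Relation.Unary.Properties using (_∩?_; ∁?; U?)

open import Algebra.Properties.CommutativeSemigroup
  (CommutativeMonoid.commutativeSemigroup ℚₚ.+-0-commutativeMonoid) using (interchange)

module _ {A B : Set} {P : Pred A 0ℓ} {Q : Pred B 0ℓ} (P? : Decidable P) (Q? : Decidable Q)
         {xs : List A} {ys : List B} (xs! : Unique xs) (ys! : Unique ys)
         (∈xs : ∀ a → a ∈ xs) (∈ys : ∀ b → b ∈ ys) where

  length-filter-bijection : (f : A → B) (g : B → A) →
    (∀ a → P a → Q (f a)) → (∀ b → Q b → P (g b)) →
    (∀ a → P a → g (f a) ≡ a) → (∀ b → Q b → f (g b) ≡ b) →
    length (filter P? xs) ≡ length (filter Q? ys)
  length-filter-bijection f g f-resp g-resp gf fg = begin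
    length (filter P? xs)          ≡⟨ length-map f (filter P? xs) ⟨
    length (map f (filter P? xs))  ≡⟨ ↭-length (∼bag⇒↭ (unique∧set⇒bag image! (Unique.filter⁺ Q? ys!) (mk⇔ to from))) ⟩
    length (filter Q? ys)          ∎
    where
    open ≡-Reasoning
    g∘f≡id : map g (map f (filter P? xs)) ≡ filter P? xs
    g∘f≡id = trans (sym (List-map-∘ (filter P? xs))) (map-id-local (All.map (gf _) (all-filter P? xs)))
    image! : Unique (map f (filter P? xs))
    image! = Unique.map⁻ {f = g} (subst Unique (sym g∘f≡id) (Unique.filter⁺ P? xs!))
    to : ∀ {z} → z ∈ map f (filter P? xs) → z ∈ filter Q? ys
    to z∈ with a , _ , refl , Pa ← ∈-map∘filter⁻ f P? {xs = xs} z∈ = ∈-filter⁺ Q? (∈ys (f a)) (f-resp a Pa)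
    from : ∀ {z} → z ∈ filter Q? ys → z ∈ map f (filter P? xs)
    from {z} z∈ with Qz ← proj₂ (∈-filter⁻ Q? {xs = ys} z∈) =
      ∈-map∘filter⁺ f P? {xs = xs} (g z , ∈xs (g z) , sym (fg z Qz) , g-resp z Qz)

module _ {A : Set} {P Q : Pred A 0ℓ} (P? : Decidable P) (Q? : Decidable Q) where

  length-filter-split : ∀ xs →
    length (filter P? xs) ≡ length (filter (P? ∩? Q?) xs) + length (filter (P? ∩? ∁? Q?) xs)
  length-filter-split []       = refl
  length-filter-split (x ∷ xs) with P? x | Q? x
  ... | yes _ | yes _ = cong suc (length-filter-split xs)
  ... | yes _ | no _  = trans (cong suc (length-filter-split xs)) (sym (+-suc _ _))
  ... | no _  | _     = length-filter-split xs

∈-length≡1 : ∀ {A : Set} {xs : List A} {x y} → length xs ≡ 1 → x ∈ xs → y ∈ xs → x ≡ y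
∈-length≡1 {xs = _ ∷ []} _ (here refl) (here refl) = refl

allVecs-cartesian : ∀ m n → allVecs (suc m) n ≡ cartesianProductWith (λ v x → x ∷ v) (allVecs m n) (allFin n)
allVecs-cartesian m n = as-product (allVecs m n)
  where
  as-product : ∀ vs → concatMap (λ v → map (_∷ v) (allFin n)) vs ≡ cartesianProductWith (λ v x → x ∷ v) vs (allFin n)
  as-product []       = refl
  as-product (v ∷ vs) = cong (map (_∷ v) (allFin n) ++_) (as-product vs)

allVecs-complete : ∀ m n (v : Vec (Fin n) m) → v ∈ allVecs m n
allVecs-complete zero    n []      = here refl
allVecs-complete (suc m) n (x ∷ v) = subst (x ∷ v ∈_) (sym (allVecs-cartesian m n))
  (∈-cartesianProductWith⁺ (λ v x → x ∷ v) (allVecs-complete m n v) (∈-allFin x))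

allVecs-unique : ∀ m n → Unique (allVecs m n)
allVecs-unique zero    n = All.[] ∷ []
allVecs-unique (suc m) n = subst Unique (sym (allVecs-cartesian m n))
  (Unique.cartesianProductWith⁺ (λ v x → x ∷ v) (swap ∘ ∷-injective) (allVecs-unique m n) (Unique.allFin⁺ n))

Word : ℕ → Set
Word n = Vec (Fin n) n

count : ∀ {n} {P : Pred (Word n) 0ℓ} → Decidable P → ℕ
count {n} P? = length (filter P? (allVecs n n))

module _ {m n} {P : Pred (Word m) 0ℓ} {Q : Pred (Word n) 0ℓ} (P? : Decidable P) (Q? : Decidable Q) where

  count-bijection : (f : Word m → Word n) (g : Word n → Word m) →
    (∀ σ → P σ → Q (f σ)) → (∀ ρ → Q ρ → P (g ρ)) →
    (∀ σ → P σ → g (f σ) ≡ σ) → (∀ ρ → Q ρ → f (g ρ) ≡ ρ) →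
    count P? ≡ count Q?
  count-bijection = length-filter-bijection P? Q? (allVecs-unique m m) (allVecs-unique n n)
                                            (allVecs-complete m m) (allVecs-complete n n)

module _ {n} {P Q : Pred (Word n) 0ℓ} (P? : Decidable P) (Q? : Decidable Q) where

  count-involution : (f : Word n → Word n) → (∀ σ → f (f σ) ≡ σ) →
    (∀ σ → P σ → Q (f σ)) → (∀ σ → Q σ → P (f σ)) → count P? ≡ count Q?
  count-involution f f-involutive P⇒Q Q⇒P =
    count-bijection P? Q? f f P⇒Q Q⇒P (λ σ _ → f-involutive σ) (λ σ _ → f-involutive σ)

  count-cong : (∀ σ → P σ → Q σ) → (∀ σ → Q σ → P σ) → count P? ≡ count Q?
  count-cong P⇒Q Q⇒P = cong length (filter-≐ P? Q? ((λ {σ} → P⇒Q σ) , (λ {σ} → Q⇒P σ)) (allVecs n n))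

  count-split : count P? ≡ count (P? ∩? Q?) + count (P? ∩? ∁? Q?)
  count-split = length-filter-split P? Q? (allVecs n n)

module _ {n m} {P : Pred (Word n) 0ℓ} (P? : Decidable P) (f : Word n → Fin m) {X : ℕ}
         (fibre-size : ∀ v → count (P? ∩? (λ σ → f σ ≟ v)) ≡ X) where

  count-fibres : count P? ≡ m * X
  count-fibres =
    trans (count-cong P? (P? ∩? below m) (λ σ Pσ → Pσ , toℕ<n (f σ)) (λ _ → proj₁)) (count-below m ≤-refl)
    where
    below : ∀ t → Decidable (λ σ → toℕ (f σ) < t)
    below t σ = toℕ (f σ) <? t

    count-below : ∀ t → t ≤ m → count (P? ∩? below t) ≡ t * X
    count-below zero    _   = cong length (filter-none (P? ∩? below zero) (All.universal (λ _ ()) (allVecs n n)))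
    count-below (suc t) t<m = begin
      count (P? ∩? below (suc t))
        ≡⟨ count-split (P? ∩? below (suc t)) (below t) ⟩
      count ((P? ∩? below (suc t)) ∩? below t) + count ((P? ∩? below (suc t)) ∩? ∁? (below t))
        ≡⟨ cong₂ _+_ (count-cong _ (P? ∩? below t) (λ _ ((Pσ , _) , σ<t) → Pσ , σ<t)
                                                   (λ _ (Pσ , σ<t) → (Pσ , ≤-trans σ<t (n≤1+n t)) , σ<t))
                     (trans (count-cong _ (P? ∩? (λ σ → f σ ≟ v)) at-v⁺ at-v⁻) (fibre-size v)) ⟩
      count (P? ∩? below t) + X
        ≡⟨ cong (_+ X) (count-below t (≤-trans (n≤1+n t) t<m)) ⟩
      t * X + X
        ≡⟨ +-comm (t * X) X ⟩
      suc t * X ∎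
      where
      open ≡-Reasoning
      v : Fin m
      v = fromℕ< t<m
      at-v⁺ : ∀ σ → (P σ × toℕ (f σ) < suc t) × ¬ toℕ (f σ) < t → P σ × f σ ≡ v
      at-v⁺ σ ((Pσ , σ≤t) , σ≮t) = Pσ , toℕ-injective (trans (≤-antisym (≤-pred σ≤t) (≮⇒≥ σ≮t)) (sym (toℕ-fromℕ< t<m)))
      at-v⁻ : ∀ σ → P σ × f σ ≡ v → (P σ × toℕ (f σ) < suc t) × ¬ toℕ (f σ) < t
      at-v⁻ σ (Pσ , σ≡v) = (Pσ , s≤s (≤-reflexive σ≡t)) , <-irrefl σ≡t
        where
        σ≡t : toℕ (f σ) ≡ t
        σ≡t = trans (cong toℕ σ≡v) (toℕ-fromℕ< t<m)

module _ {n} (i j : Fin n) where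

  transpose-matchˡ : transpose i j i ≡ j
  transpose-matchˡ rewrite dec-true (i ≟ i) refl = refl

  transpose-matchʳ : transpose i j j ≡ i
  transpose-matchʳ with j ≟ i
  ... | yes j≡i = j≡i
  ... | no _ rewrite dec-true (j ≟ j) refl = refl

  transpose-other : ∀ {k} → k ≢ i → k ≢ j → transpose i j k ≡ k
  transpose-other {k} k≢i k≢j rewrite dec-false (k ≟ i) k≢i | dec-false (k ≟ j) k≢j = refl

  transpose-involutive : ∀ k → transpose i j (transpose i j k) ≡ k
  transpose-involutive k = by-cases (k ≟ i) (k ≟ j)
    where
    by-cases : Dec (k ≡ i) → Dec (k ≡ j) → transpose i j (transpose i j k) ≡ k
    by-cases (yes refl) _          = trans (cong (transpose i j) transpose-matchˡ) transpose-matchʳ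
    by-cases (no _)     (yes refl) = trans (cong (transpose i j) transpose-matchʳ) transpose-matchˡ
    by-cases (no k≢i)   (no k≢j)   = trans (cong (transpose i j) (transpose-other k≢i k≢j)) (transpose-other k≢i k≢j)

  swapValues : Word n → Word n
  swapValues = Vec.map (transpose i j)

  lookup-swapValues : ∀ σ k → lookup (swapValues σ) k ≡ transpose i j (lookup σ k)
  lookup-swapValues σ k = lookup-map k (transpose i j) σ

  swapValues-involutive : ∀ σ → swapValues (swapValues σ) ≡ σ
  swapValues-involutive σ = trans (sym (map-∘ _ _ σ)) (trans (map-cong transpose-involutive σ) (map-id σ))

  swapValues-isPerm : ∀ σ → IsPerm σ → IsPerm (swapValues σ)
  swapValues-isPerm σ σ-inj k l eq = σ-inj k l (begin
    lookup σ k                                  ≡⟨ transpose-involutive _ ⟨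
    transpose i j (transpose i j (lookup σ k))  ≡⟨ cong (transpose i j) same-image ⟩
    transpose i j (transpose i j (lookup σ l))  ≡⟨ transpose-involutive _ ⟩
    lookup σ l                                  ∎)
    where
    open ≡-Reasoning
    same-image : transpose i j (lookup σ k) ≡ transpose i j (lookup σ l)
    same-image = trans (sym (lookup-swapValues σ k)) (trans eq (lookup-swapValues σ l))

Fixes : ∀ {n} → Fin n → Word n → Set
Fixes i σ = lookup σ i ≡ i

fixes? : ∀ {n} (i : Fin n) → Decidable (Fixes i)
fixes? i σ = lookup σ i ≟ i

IsPerm-surjective : ∀ {n} (σ : Word n) → IsPerm σ → ∀ y → ∃ λ i → lookup σ i ≡ y
IsPerm-surjective {suc n} σ σ-inj y with any? (λ i → lookup σ i ≟ y)
... | yes hit = hit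
... | no miss =
  let avoids : ∀ i → y ≢ lookup σ i
      avoids i y≡σi = miss (i , sym y≡σi)
      i , j , i<j , eq = pigeonhole (n<1+n n) (λ i → punchOut (avoids i))
  in contradiction (σ-inj i j (punchOut-injective (avoids i) (avoids j) eq)) (<⇒≢ᶠ i<j)

data PunchInView {n} (c : Fin (suc n)) : Fin (suc n) → Set where
  at      : PunchInView c c
  punched : ∀ j → PunchInView c (punchIn c j)

punchInView : ∀ {n} (c i : Fin (suc n)) → PunchInView c i
punchInView c i with i ≟ c
... | yes refl = at
... | no i≢c   = subst (PunchInView c) (punchIn-punchOut (i≢c ∘ sym)) (punched _)

toℕ-punchIn-≤ : ∀ {n} (c : Fin (suc n)) j → toℕ (punchIn c j) ≤ suc (toℕ j)
toℕ-punchIn-≤ zero    j       = ≤-refl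
toℕ-punchIn-≤ (suc c) zero    = z≤n
toℕ-punchIn-≤ (suc c) (suc j) = s≤s (toℕ-punchIn-≤ c j)

toℕ-punchIn-≥ : ∀ {n} (c : Fin (suc n)) j → toℕ c ≤ toℕ j → toℕ (punchIn c j) ≡ suc (toℕ j)
toℕ-punchIn-≥ zero    j       _         = refl
toℕ-punchIn-≥ (suc c) (suc j) (s≤s c≤j) = cong suc (toℕ-punchIn-≥ c j c≤j)

module _ {n} (c : Fin (suc n)) where

  punchOutOr : Fin n → Fin (suc n) → Fin n
  punchOutOr default k with c ≟ k
  ... | yes _   = default
  ... | no c≢k = punchOut c≢k

  punchIn-punchOutOr : ∀ {default k} → c ≢ k → punchIn c (punchOutOr default k) ≡ k
  punchIn-punchOutOr {default} {k} c≢k with c ≟ k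
  ... | yes c≡k = contradiction c≡k c≢k
  ... | no c≢k′ = punchIn-punchOut c≢k′

  -- The default j is a junk value: it is only used when σ (punchIn c j) = c, which never
  -- happens for a permutation σ fixing c.
  deleteFixedPoint : Word (suc n) → Word n
  deleteFixedPoint σ = tabulate λ j → punchOutOr j (lookup σ (punchIn c j))

  insertAt : Word n → Fin (suc n) → Fin (suc n)
  insertAt ρ i with i ≟ c
  ... | yes _   = c
  ... | no i≢c = punchIn c (lookup ρ (punchOut (i≢c ∘ sym)))

  insertFixedPoint : Word n → Word (suc n)
  insertFixedPoint ρ = tabulate (insertAt ρ)

  insertFixedPoint-fixes : ∀ ρ → Fixes c (insertFixedPoint ρ)
  insertFixedPoint-fixes ρ rewrite lookup∘tabulate (insertAt ρ) c with c ≟ c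
  ... | yes _   = refl
  ... | no c≢c = contradiction refl c≢c

  lookup-insertFixedPoint : ∀ ρ j → lookup (insertFixedPoint ρ) (punchIn c j) ≡ punchIn c (lookup ρ j)
  lookup-insertFixedPoint ρ j rewrite lookup∘tabulate (insertAt ρ) (punchIn c j) with punchIn c j ≟ c
  ... | yes eq = contradiction eq (punchInᵢ≢i c j)
  ... | no _   = cong (punchIn c ∘ lookup ρ) (trans (punchOut-cong c refl) (punchOut-punchIn c))

  module _ (σ : Word (suc n)) (σ-inj : IsPerm σ) (σ-fixes : Fixes c σ) where

    lookup-deleteFixedPoint : ∀ j → punchIn c (lookup (deleteFixedPoint σ) j) ≡ lookup σ (punchIn c j)
    lookup-deleteFixedPoint j rewrite lookup∘tabulate (λ j → punchOutOr j (lookup σ (punchIn c j))) j =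
      punchIn-punchOutOr (λ c≡σj → punchInᵢ≢i c j (σ-inj _ _ (trans (sym c≡σj) (sym σ-fixes))))

    deleteFixedPoint-fixes⁺ : ∀ {j} → Fixes j (deleteFixedPoint σ) → Fixes (punchIn c j) σ
    deleteFixedPoint-fixes⁺ {j} fixed = trans (sym (lookup-deleteFixedPoint j)) (cong (punchIn c) fixed)

    deleteFixedPoint-fixes⁻ : ∀ {j} → Fixes (punchIn c j) σ → Fixes j (deleteFixedPoint σ)
    deleteFixedPoint-fixes⁻ {j} fixed = punchIn-injective c _ _ (trans (lookup-deleteFixedPoint j) fixed)

    deleteFixedPoint-isPerm : IsPerm (deleteFixedPoint σ)
    deleteFixedPoint-isPerm i j eq = punchIn-injective c i j (σ-inj _ _ (begin
      lookup σ (punchIn c i)                     ≡⟨ lookup-deleteFixedPoint i ⟨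
      punchIn c (lookup (deleteFixedPoint σ) i)  ≡⟨ cong (punchIn c) eq ⟩
      punchIn c (lookup (deleteFixedPoint σ) j)  ≡⟨ lookup-deleteFixedPoint j ⟩
      lookup σ (punchIn c j)                     ∎))
      where open ≡-Reasoning

    insert∘delete : insertFixedPoint (deleteFixedPoint σ) ≡ σ
    insert∘delete = Pointwise-≡⇒≡ (ext λ i → agree (punchInView c i))
      where
      agree : ∀ {i} → PunchInView c i → lookup (insertFixedPoint (deleteFixedPoint σ)) i ≡ lookup σ i
      agree at          = trans (insertFixedPoint-fixes _) (sym σ-fixes)
      agree (punched j) = trans (lookup-insertFixedPoint _ j) (lookup-deleteFixedPoint j)

  insertFixedPoint-isPerm : ∀ ρ → IsPerm ρ → IsPerm (insertFixedPoint ρ)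
  insertFixedPoint-isPerm ρ ρ-inj i i′ = agree (punchInView c i) (punchInView c i′)
    where
    lookup-punched : ∀ j → lookup (insertFixedPoint ρ) (punchIn c j) ≢ lookup (insertFixedPoint ρ) c
    lookup-punched j eq =
      punchInᵢ≢i c _ (trans (sym (lookup-insertFixedPoint ρ j)) (trans eq (insertFixedPoint-fixes ρ)))
    agree : ∀ {i i′} → PunchInView c i → PunchInView c i′ →
            lookup (insertFixedPoint ρ) i ≡ lookup (insertFixedPoint ρ) i′ → i ≡ i′
    agree at          at           _  = refl
    agree at          (punched j′) eq = contradiction (sym eq) (lookup-punched j′)
    agree (punched j) at           eq = contradiction eq (lookup-punched j)
    agree (punched j) (punched j′) eq = cong (punchIn c) (ρ-inj j j′ (punchIn-injective c _ _
      (trans (sym (lookup-insertFixedPoint ρ j)) (trans eq (lookup-insertFixedPoint ρ j′)))))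

  delete∘insert : ∀ ρ → IsPerm ρ → deleteFixedPoint (insertFixedPoint ρ) ≡ ρ
  delete∘insert ρ ρ-inj = Pointwise-≡⇒≡ (ext λ j → punchIn-injective c _ _ (trans
    (lookup-deleteFixedPoint (insertFixedPoint ρ) (insertFixedPoint-isPerm ρ ρ-inj) (insertFixedPoint-fixes ρ) j)
    (lookup-insertFixedPoint ρ j)))

  count-deleteFixedPoint : ∀ {Φ : Pred (Word n) 0ℓ} (Φ? : Decidable Φ) →
    count ((isPerm? ∩? fixes? c) ∩? (Φ? ∘ deleteFixedPoint)) ≡ count (isPerm? ∩? Φ?)
  count-deleteFixedPoint {Φ} Φ? = count-bijection _ _ deleteFixedPoint insertFixedPoint
    (λ { σ ((σ-inj , σ-fixes) , Φσ) → deleteFixedPoint-isPerm σ σ-inj σ-fixes , Φσ })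
    (λ { ρ (ρ-inj , Φρ) → (insertFixedPoint-isPerm ρ ρ-inj , insertFixedPoint-fixes ρ) ,
                           subst Φ (sym (delete∘insert ρ ρ-inj)) Φρ })
    (λ { σ ((σ-inj , σ-fixes) , _) → insert∘delete σ σ-inj σ-fixes })
    (λ { ρ (ρ-inj , _) → delete∘insert ρ ρ-inj })

permutations-count : ∀ n → count (isPerm? {n}) ≡ n !
permutations-count zero    = refl
permutations-count (suc n) = count-fibres isPerm? (λ σ → lookup σ last) fibre-size
  where
  last : Fin (suc n)
  last = fromℕ n

  fibre-size : ∀ v → count (isPerm? ∩? (λ σ → lookup σ last ≟ v)) ≡ n !
  fibre-size v = begin
    count (isPerm? ∩? (λ σ → lookup σ last ≟ v))
      ≡⟨ count-involution _ ((isPerm? ∩? fixes? last) ∩? (U? ∘ deleteFixedPoint last))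
                          (swapValues v last) (swapValues-involutive v last) to-last from-last ⟩
    count ((isPerm? ∩? fixes? last) ∩? (U? ∘ deleteFixedPoint last))
      ≡⟨ count-deleteFixedPoint last U? ⟩
    count (isPerm? {n} ∩? U?)
      ≡⟨ count-cong _ (isPerm? {n}) (λ _ → proj₁) (λ _ σ-inj → σ-inj , _) ⟩
    count (isPerm? {n})
      ≡⟨ permutations-count n ⟩
    n ! ∎
    where
    open ≡-Reasoning
    to-last : ∀ σ → IsPerm σ × lookup σ last ≡ v →
      (IsPerm (swapValues v last σ) × Fixes last (swapValues v last σ)) × U (deleteFixedPoint last (swapValues v last σ))
    to-last σ (σ-inj , σ-last) = (swapValues-isPerm v last σ σ-inj , σ′-fixes) , _
      where
      σ′-fixes : Fixes last (swapValues v last σ)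
      σ′-fixes = trans (lookup-swapValues v last σ last) (trans (cong (transpose v last) σ-last) (transpose-matchˡ v last))
    from-last : ∀ σ → (IsPerm σ × Fixes last σ) × U (deleteFixedPoint last σ) →
      IsPerm (swapValues v last σ) × lookup (swapValues v last σ) last ≡ v
    from-last σ ((σ-inj , σ-fixes) , _) = swapValues-isPerm v last σ σ-inj , σ′-last
      where
      σ′-last : lookup (swapValues v last σ) last ≡ v
      σ′-last = trans (lookup-swapValues v last σ last) (trans (cong (transpose v last) σ-fixes) (transpose-matchʳ v last))

NoFixedPointFrom : ∀ {n} → ℕ → Word n → Set
NoFixedPointFrom b σ = ∀ i → b ≤ toℕ i → ¬ Fixes i σ

noFixedPointFrom? : ∀ {n} b → Decidable (NoFixedPointFrom {n} b)
noFixedPointFrom? b σ = all? λ i → (b ≤? toℕ i) →-dec ¬? (fixes? i σ)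

noFixedPointFrom-weaken : ∀ {n b} (σ : Word n) → NoFixedPointFrom b σ → NoFixedPointFrom (suc b) σ
noFixedPointFrom-weaken {b = b} _ noFix i b<i = noFix i (≤-trans (n≤1+n b) b<i)

module _ {n} (c : Fin (suc n)) {b} (toℕ-c : toℕ c ≡ b) (σ : Word (suc n)) where

  noFixedPointFrom-strengthen : NoFixedPointFrom (suc b) σ → ¬ Fixes c σ → NoFixedPointFrom b σ
  noFixedPointFrom-strengthen noFix c-unfixed i b≤i with toℕ i ℕ.≟ b
  ... | yes i≡b = subst (λ k → ¬ Fixes k σ) (toℕ-injective (trans toℕ-c (sym i≡b))) c-unfixed
  ... | no i≢b  = noFix i (≤∧≢⇒< b≤i (i≢b ∘ sym))

  module _ (σ-inj : IsPerm σ) (σ-fixes : Fixes c σ) where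

    noFixedPointFrom-deleteFixedPoint⁺ : NoFixedPointFrom (suc b) σ → NoFixedPointFrom b (deleteFixedPoint c σ)
    noFixedPointFrom-deleteFixedPoint⁺ noFix j b≤j =
      noFix (punchIn c j) (subst (suc b ≤_) (sym shifted) (s≤s b≤j)) ∘ deleteFixedPoint-fixes⁺ c σ σ-inj σ-fixes
      where
      shifted : toℕ (punchIn c j) ≡ suc (toℕ j)
      shifted = toℕ-punchIn-≥ c j (subst (_≤ toℕ j) (sym toℕ-c) b≤j)

    noFixedPointFrom-deleteFixedPoint⁻ : NoFixedPointFrom b (deleteFixedPoint c σ) → NoFixedPointFrom (suc b) σ
    noFixedPointFrom-deleteFixedPoint⁻ noFix i = noFixAt (punchInView c i)
      where
      noFixAt : ∀ {i} → PunchInView c i → suc b ≤ toℕ i → ¬ Fixes i σ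
      noFixAt at          b<c _ = <-irrefl (sym toℕ-c) b<c
      noFixAt (punched j) b<i   =
        noFix j (≤-pred (≤-trans b<i (toℕ-punchIn-≤ c j))) ∘ deleteFixedPoint-fixes⁻ c σ σ-inj σ-fixes

partialDerangements : ℕ → ℕ → ℕ
partialDerangements n b = count (isPerm? {n} ∩? noFixedPointFrom? b)

partialDerangements-pascal : ∀ {N b} → b < suc N →
  partialDerangements (suc N) (suc b) ≡ partialDerangements N b + partialDerangements (suc N) b
partialDerangements-pascal {N} {b} b<1+N = begin
  partialDerangements (suc N) (suc b)
    ≡⟨ count-split (isPerm? ∩? noFixedPointFrom? (suc b)) (fixes? c) ⟩
  count ((isPerm? ∩? noFixedPointFrom? (suc b)) ∩? fixes? c) +
  count ((isPerm? ∩? noFixedPointFrom? (suc b)) ∩? ∁? (fixes? c))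
    ≡⟨ cong₂ _+_
         (trans (count-cong _ ((isPerm? ∩? fixes? c) ∩? (noFixedPointFrom? b ∘ deleteFixedPoint c))
                            fixed⇒deleted deleted⇒fixed)
                (count-deleteFixedPoint c (noFixedPointFrom? b)))
         (count-cong _ (isPerm? ∩? noFixedPointFrom? b) unfixed⇒from-b from-b⇒unfixed) ⟩
  partialDerangements N b + partialDerangements (suc N) b ∎
  where
  open ≡-Reasoning
  c : Fin (suc N)
  c = fromℕ< b<1+N
  toℕ-c : toℕ c ≡ b
  toℕ-c = toℕ-fromℕ< b<1+N

  fixed⇒deleted : ∀ σ → (IsPerm σ × NoFixedPointFrom (suc b) σ) × Fixes c σ →
                  (IsPerm σ × Fixes c σ) × NoFixedPointFrom b (deleteFixedPoint c σ)
  fixed⇒deleted σ ((σ-inj , noFix) , σ-fixes) =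
    (σ-inj , σ-fixes) , noFixedPointFrom-deleteFixedPoint⁺ c toℕ-c σ σ-inj σ-fixes noFix

  deleted⇒fixed : ∀ σ → (IsPerm σ × Fixes c σ) × NoFixedPointFrom b (deleteFixedPoint c σ) →
                  (IsPerm σ × NoFixedPointFrom (suc b) σ) × Fixes c σ
  deleted⇒fixed σ ((σ-inj , σ-fixes) , noFix) =
    (σ-inj , noFixedPointFrom-deleteFixedPoint⁻ c toℕ-c σ σ-inj σ-fixes noFix) , σ-fixes

  unfixed⇒from-b : ∀ σ → (IsPerm σ × NoFixedPointFrom (suc b) σ) × ¬ Fixes c σ → IsPerm σ × NoFixedPointFrom b σ
  unfixed⇒from-b σ ((σ-inj , noFix) , c-unfixed) = σ-inj , noFixedPointFrom-strengthen c toℕ-c σ noFix c-unfixed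

  from-b⇒unfixed : ∀ σ → IsPerm σ × NoFixedPointFrom b σ → (IsPerm σ × NoFixedPointFrom (suc b) σ) × ¬ Fixes c σ
  from-b⇒unfixed σ (σ-inj , noFix) = (σ-inj , noFixedPointFrom-weaken σ noFix) , noFix c (≤-reflexive (sym toℕ-c))

partialDerangements-diagonal : ∀ n → partialDerangements n n ≡ n !
partialDerangements-diagonal n =
  trans (count-cong _ (isPerm? {n}) (λ _ → proj₁) (λ σ σ-inj → σ-inj , vacuous σ)) (permutations-count n)
  where
  vacuous : ∀ σ → NoFixedPointFrom n σ
  vacuous σ i n≤i = contradiction (toℕ<n i) (≤⇒≯ n≤i)

module _ {n} (σ : Word (suc n)) where

  isRLMin-last : IsRLMin σ (fromℕ n)
  isRLMin-last k last<k = contradiction (≤fromℕ k) (<⇒≱ last<k)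

  isRLMin-zero : IsPerm σ → ∀ {p} → lookup σ p ≡ zero → IsRLMin σ p
  isRLMin-zero σ-inj {p} σp≡0 k p<k rewrite σp≡0 with lookup σ k in σk
  ... | zero  = contradiction (σ-inj p k (trans σp≡0 (sym σk))) (<⇒≢ᶠ p<k)
  ... | suc _ = s≤s z≤n

  module _ (σ-last : lookup σ (fromℕ n) ≡ zero) where

    isRLMin⇒last : ∀ {i} → IsRLMin σ i → i ≡ fromℕ n
    isRLMin⇒last {i} i-min with i ≟ fromℕ n
    ... | yes i≡last = i≡last
    ... | no i≢last  =
      contradiction (subst (lookup σ i Fin.<_) σ-last (i-min _ (≤∧≢⇒<ᶠ (≤fromℕ i) i≢last))) λ ()

    numRLMin≡1 : numRLMin σ ≡ 1
    numRLMin≡1 = length-filter-bijection (isRLMin? σ) (U? {A = Fin 1}) (Unique.allFin⁺ (suc n)) (Unique.allFin⁺ 1)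
      ∈-allFin ∈-allFin (λ _ → zero) (λ _ → fromℕ n) _ (λ _ _ → isRLMin-last)
      (λ _ i-min → sym (isRLMin⇒last i-min)) (λ { zero _ → refl })

  numRLMin≡1⇒last↦zero : IsPerm σ → numRLMin σ ≡ 1 → lookup σ (fromℕ n) ≡ zero
  numRLMin≡1⇒last↦zero σ-inj one with p , σp≡0 ← IsPerm-surjective σ σ-inj zero =
    subst (λ i → lookup σ i ≡ zero) (∈-length≡1 one (isRLMin∈ (isRLMin-zero σ-inj σp≡0)) (isRLMin∈ isRLMin-last)) σp≡0
    where
    isRLMin∈ : ∀ {i} → IsRLMin σ i → i ∈ filter (isRLMin? σ) (allFin (suc n))
    isRLMin∈ {i} = ∈-filter⁺ (isRLMin? σ) (∈-allFin i)

module _ {n : ℕ} where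

  private
    last : Fin (2 + n)
    last = fromℕ (suc n)

    τ : Fin (2 + n) → Fin (2 + n)
    τ = transpose zero last

    last≢zero : last ≢ zero
    last≢zero ()

    τ-punched : ∀ j → τ (punchIn last (suc j)) ≡ punchIn last (suc j)
    τ-punched j = transpose-other zero last (λ ()) (punchInᵢ≢i last (suc j))

  module _ (σ : Word (2 + n)) (σ-inj : IsPerm σ) where

    endsInZero⇒swapFixesLast : IsDerangement σ → lookup σ last ≡ zero →
      Fixes last (swapValues zero last σ) × NoFixedPointFrom 1 (deleteFixedPoint last (swapValues zero last σ))
    endsInZero⇒swapFixesLast der σ-last = σ′-fixes , no-fix
      where
      σ′-fixes : Fixes last (swapValues zero last σ)
      σ′-fixes = trans (lookup-swapValues zero last σ last) (trans (cong τ σ-last) (transpose-matchˡ zero last))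
      no-fix : NoFixedPointFrom 1 (deleteFixedPoint last (swapValues zero last σ))
      no-fix (suc j) _ fixed = der i (begin
        lookup σ i          ≡⟨ transpose-involutive zero last _ ⟨
        τ (τ (lookup σ i))  ≡⟨ cong τ (trans (sym (lookup-swapValues zero last σ i)) σ′-fixes-i) ⟩
        τ i                 ≡⟨ τ-punched j ⟩
        i                   ∎)
        where
        open ≡-Reasoning
        i : Fin (2 + n)
        i = punchIn last (suc j)
        σ′-fixes-i : Fixes i (swapValues zero last σ)
        σ′-fixes-i =
          deleteFixedPoint-fixes⁺ last (swapValues zero last σ) (swapValues-isPerm zero last σ σ-inj) σ′-fixes fixed

    fixesLast⇒swapEndsInZero : Fixes last σ → NoFixedPointFrom 1 (deleteFixedPoint last σ) →
      IsDerangement (swapValues zero last σ) × lookup (swapValues zero last σ) last ≡ zero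
    fixesLast⇒swapEndsInZero σ-fixes no-fix = (λ i → not-fixed (punchInView last i)) , σ′-last
      where
      σ′-last : lookup (swapValues zero last σ) last ≡ zero
      σ′-last = trans (lookup-swapValues zero last σ last) (trans (cong τ σ-fixes) (transpose-matchʳ zero last))
      σ-is-τ : ∀ {i} → Fixes i (swapValues zero last σ) → lookup σ i ≡ τ i
      σ-is-τ {i} fixed =
        trans (sym (transpose-involutive zero last _)) (cong τ (trans (sym (lookup-swapValues zero last σ i)) fixed))
      not-fixed : ∀ {i} → PunchInView last i → ¬ Fixes i (swapValues zero last σ)
      not-fixed at                fixed = last≢zero (trans (sym fixed) σ′-last)
      not-fixed (punched zero)    fixed =
        last≢zero (σ-inj last zero (trans σ-fixes (sym (trans (σ-is-τ fixed) (transpose-matchˡ zero last)))))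
      not-fixed (punched (suc j)) fixed =
        no-fix (suc j) (s≤s z≤n) (deleteFixedPoint-fixes⁻ last σ σ-inj σ-fixes (trans (σ-is-τ fixed) (τ-punched j)))

d≡partialDerangements : ∀ n → d (suc (suc n)) 1 ≡ partialDerangements (suc n) 1
d≡partialDerangements n = begin
  d (suc (suc n)) 1
    ≡⟨ count-cong _ endsInZero? (λ σ (σ-inj , der , one) → σ-inj , der , numRLMin≡1⇒last↦zero σ σ-inj one)
                                (λ σ (σ-inj , der , σ-last) → σ-inj , der , numRLMin≡1 σ σ-last) ⟩
  count endsInZero?
    ≡⟨ count-involution endsInZero? fixesLast? (swapValues zero last) (swapValues-involutive zero last)
         (λ σ (σ-inj , der , σ-last) → let fixes , no-fix = endsInZero⇒swapFixesLast σ σ-inj der σ-last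
                                        in (swapValues-isPerm zero last σ σ-inj , fixes) , no-fix)
         (λ σ ((σ-inj , σ-fixes) , no-fix) → let der , σ′-last = fixesLast⇒swapEndsInZero σ σ-inj σ-fixes no-fix
                                             in swapValues-isPerm zero last σ σ-inj , der , σ′-last) ⟩
  count fixesLast?
    ≡⟨ count-deleteFixedPoint last (noFixedPointFrom? 1) ⟩
  partialDerangements (suc n) 1 ∎
  where
  open ≡-Reasoning
  last : Fin (2 + n)
  last = fromℕ (suc n)
  endsInZero? : Decidable (λ σ → IsPerm σ × IsDerangement σ × lookup σ last ≡ zero)
  endsInZero? = isPerm? ∩? (isDerangement? ∩? (λ σ → lookup σ last ≟ zero))
  fixesLast? : Decidable (λ σ → (IsPerm σ × Fixes last σ) × NoFixedPointFrom 1 (deleteFixedPoint last σ))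
  fixesLast? = (isPerm? ∩? fixes? last) ∩? (noFixedPointFrom? 1 ∘ deleteFixedPoint last)

module PascalArray (u : ℕ → ℕ → ℕ) (u-pascal : ∀ b k → u (suc b) k ≡ u b k + u b (suc k))
                   (u-head : ∀ b → u b 0 ≡ b !) where

  private
    -- k ∸ 1 truncates at k = 0, where the factor k makes both sides vanish
    scaled-pascal-pred : ∀ b k → k * u (suc b) (k ∸ 1) ≡ k * (u b (k ∸ 1) + u b k)
    scaled-pascal-pred b zero    = refl
    scaled-pascal-pred b (suc k) = cong (suc k *_) (u-pascal b k)

    rearrange : ∀ b k y z w →
      (suc b + k) * (z + y) + k * (w + z) ≡ ((b + k) * z + k * w) + ((b + suc k) * y + suc k * z)
    rearrange = ℕ-Solver.solve-∀

  column-recurrence : ∀ b k → u b (suc k) ≡ (b + k) * u b k + k * u b (k ∸ 1)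
  column-recurrence b zero = +-cancelˡ-≡ (b !) _ _ (begin
    b ! + u b 1                  ≡⟨ cong (_+ u b 1) (u-head b) ⟨
    u b 0 + u b 1                ≡⟨ u-pascal b 0 ⟨
    u (suc b) 0                  ≡⟨ u-head (suc b) ⟩
    b ! + b * b !                ≡⟨ cong (b ! +_) (trans (+-identityʳ _) (cong₂ _*_ (+-identityʳ b) (u-head b))) ⟨
    b ! + ((b + 0) * u b 0 + 0)  ∎)
    where open ≡-Reasoning
  column-recurrence b (suc k) = +-cancelˡ-≡ y _ _ (begin
    y + u b (2 + k)                                        ≡⟨ u-pascal b (suc k) ⟨
    u (suc b) (suc k)                                      ≡⟨ column-recurrence (suc b) k ⟩
    (suc b + k) * u (suc b) k + k * u (suc b) (k ∸ 1)      ≡⟨ cong₂ (λ s t → (suc b + k) * s + t)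
                                                                    (u-pascal b k) (scaled-pascal-pred b k) ⟩
    (suc b + k) * (z + y) + k * (w + z)                    ≡⟨ rearrange b k y z w ⟩
    ((b + k) * z + k * w) + ((b + suc k) * y + suc k * z)  ≡⟨ cong (_+ ((b + suc k) * y + suc k * z))
                                                                   (column-recurrence b k) ⟨
    y + ((b + suc k) * y + suc k * z)                      ∎)
    where
    open ≡-Reasoning
    y z w : ℕ
    y = u b (suc k)
    z = u b k
    w = u b (k ∸ 1)

infixl 7 _/!_

_/!_ : ℤ → ℕ → ℚ
x /! n = (x / n !) {{n !≢0}}

+-common-denominator : ∀ (x y : ℤ) c q .{{_ : NonZero q}} .{{_ : NonZero (suc c * q)}} →
  x / q ℚ.+ y / (suc c * q) ≡ (+ suc c ℤ.* x ℤ.+ y) / (suc c * q)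
+-common-denominator x y c (suc q) = toℚᵘ-injective (begin
  toℚᵘ (x / suc q ℚ.+ y / (suc c * suc q))          ≈⟨ toℚᵘ-homo-+ (x / suc q) (y / (suc c * suc q)) ⟩
  toℚᵘ (x / suc q) ℚᵘ.+ toℚᵘ (y / (suc c * suc q))  ≈⟨ ℚᵘₚ.+-cong (toℚᵘ-fromℚᵘ (x ℚᵘ./ suc q))
                                                                 (toℚᵘ-fromℚᵘ (y ℚᵘ./ (suc c * suc q))) ⟩
  (x ℚᵘ./ suc q) ℚᵘ.+ (y ℚᵘ./ (suc c * suc q))      ≈⟨ *≡* cross-multiplied ⟩
  (+ suc c ℤ.* x ℤ.+ y) ℚᵘ./ (suc c * suc q)        ≈⟨ toℚᵘ-fromℚᵘ _ ⟨
  toℚᵘ ((+ suc c ℤ.* x ℤ.+ y) / (suc c * suc q))    ∎)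
  where
  open ℚᵘₚ.≃-Reasoning
  ring : ∀ x y C Q → (x ℤ.* (C ℤ.* Q) ℤ.+ y ℤ.* Q) ℤ.* (C ℤ.* Q) ≡ (C ℤ.* x ℤ.+ y) ℤ.* (Q ℤ.* (C ℤ.* Q))
  ring = ℤ-Solver.solve-∀
  cross-multiplied : (x ℤ.* + (suc c * suc q) ℤ.+ y ℤ.* + suc q) ℤ.* + (suc c * suc q)
                   ≡ (+ suc c ℤ.* x ℤ.+ y) ℤ.* + (suc q * (suc c * suc q))
  cross-multiplied rewrite pos-* (suc q) (suc c * suc q) | pos-* (suc c) (suc q) = ring x y (+ suc c) (+ suc q)

sumTo-cong : ∀ n {f g : ℕ → ℚ} → (∀ k → k ≤ n → f k ≡ g k) → sumTo n f ≡ sumTo n g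
sumTo-cong zero    f≗g = f≗g zero z≤n
sumTo-cong (suc n) f≗g = cong₂ ℚ._+_ (sumTo-cong n (λ k k≤n → f≗g k (m≤n⇒m≤1+n k≤n))) (f≗g (suc n) ≤-refl)

sumTo-+ : ∀ n (f g : ℕ → ℚ) → sumTo n (λ k → f k ℚ.+ g k) ≡ sumTo n f ℚ.+ sumTo n g
sumTo-+ zero    f g = refl
sumTo-+ (suc n) f g = trans (cong (ℚ._+ (f (suc n) ℚ.+ g (suc n))) (sumTo-+ n f g))
                            (interchange (sumTo n f) (sumTo n g) (f (suc n)) (g (suc n)))

⋆-geom⋆geom-suc : ∀ f n → (f ⋆ (geom ⋆ geom)) (suc n) ≡ (f ⋆ (geom ⋆ geom)) n ℚ.+ sumTo (suc n) f
⋆-geom⋆geom-suc f n = begin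
  sumTo n (λ k → f k ℚ.* G (suc n ∸ k)) ℚ.+ f (suc n) ℚ.* G (n ∸ n)
    ≡⟨ cong₂ ℚ._+_ (sumTo-cong n shift) (trans (cong (λ j → f (suc n) ℚ.* G j) (n∸n≡0 n)) (ℚₚ.*-identityʳ _)) ⟩
  sumTo n (λ k → f k ℚ.* G (n ∸ k) ℚ.+ f k) ℚ.+ f (suc n)
    ≡⟨ cong (ℚ._+ f (suc n)) (sumTo-+ n _ f) ⟩
  ((f ⋆ G) n ℚ.+ sumTo n f) ℚ.+ f (suc n)
    ≡⟨ ℚₚ.+-assoc ((f ⋆ G) n) (sumTo n f) (f (suc n)) ⟩
  (f ⋆ G) n ℚ.+ sumTo (suc n) f ∎
  where
  open ≡-Reasoning
  G : ℕ → ℚ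
  G = geom ⋆ geom
  shift : ∀ k → k ≤ n → f k ℚ.* G (suc n ∸ k) ≡ f k ℚ.* G (n ∸ k) ℚ.+ f k
  shift k k≤n = begin
    f k ℚ.* G (suc n ∸ k)             ≡⟨ cong (λ j → f k ℚ.* G j) (+-∸-assoc 1 k≤n) ⟩
    f k ℚ.* (G (n ∸ k) ℚ.+ 1ℚ)        ≡⟨ ℚₚ.*-distribˡ-+ (f k) (G (n ∸ k)) 1ℚ ⟩
    f k ℚ.* G (n ∸ k) ℚ.+ f k ℚ.* 1ℚ  ≡⟨ cong (f k ℚ.* G (n ∸ k) ℚ.+_) (ℚₚ.*-identityʳ (f k)) ⟩
    f k ℚ.* G (n ∸ k) ℚ.+ f k         ∎

sign-suc : ∀ m → sign (suc m) ≡ - sign m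
sign-suc zero          = refl
sign-suc (suc zero)    = refl
sign-suc (suc (suc m)) = sign-suc m

module DerangementSequence (D : ℕ → ℕ) (D₀ : D 0 ≡ 1) (D₁ : D 1 ≡ 0)
                           (D-rec : ∀ m → D (2 + m) ≡ suc m * (D (suc m) + D m)) where

  D-alternating : ∀ m → + D (suc m) ≡ + suc m ℤ.* + D m ℤ.+ sign (suc m)
  D-alternating zero rewrite D₀ | D₁ = refl
  D-alternating (suc m) = begin
    + D (2 + m)                                        ≡⟨ cong +_ (D-rec m) ⟩
    + (suc m * (D (suc m) + D m))                      ≡⟨ trans (pos-* (suc m) _) (cong (+ suc m ℤ.*_) (pos-+ _ (D m))) ⟩
    + suc m ℤ.* (+ D (suc m) ℤ.+ + D m)                ≡⟨ cong (λ x → + suc m ℤ.* (x ℤ.+ + D m)) (D-alternating m) ⟩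
    + suc m ℤ.* ((+ suc m ℤ.* + D m ℤ.+ s) ℤ.+ + D m)  ≡⟨ ring (+ m) (+ D m) s ⟩
    + (2 + m) ℤ.* (+ suc m ℤ.* + D m ℤ.+ s) ℤ.+ - s    ≡⟨ cong₂ (λ x t → + (2 + m) ℤ.* x ℤ.+ t)
                                                                (D-alternating m) (sign-suc (suc m)) ⟨
    + (2 + m) ℤ.* + D (suc m) ℤ.+ sign (2 + m)         ∎
    where
    open ≡-Reasoning
    s : ℤ
    s = sign (suc m)
    ring : ∀ m d s →
      (+ 1 ℤ.+ m) ℤ.* (((+ 1 ℤ.+ m) ℤ.* d ℤ.+ s) ℤ.+ d) ≡ (+ 2 ℤ.+ m) ℤ.* ((+ 1 ℤ.+ m) ℤ.* d ℤ.+ s) ℤ.+ - s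
    ring = ℤ-Solver.solve-∀

  sumTo-expNeg : ∀ m → sumTo m expNeg ≡ + D m /! m
  sumTo-expNeg zero    = cong (λ d → + d /! 0) (sym D₀)
  sumTo-expNeg (suc m) = begin
    sumTo m expNeg ℚ.+ expNeg (suc m)              ≡⟨ cong (ℚ._+ expNeg (suc m)) (sumTo-expNeg m) ⟩
    + D m /! m ℚ.+ sign (suc m) /! suc m           ≡⟨ +-common-denominator (+ D m) (sign (suc m)) m (m !)
                                                                           {{m !≢0}} {{suc m !≢0}} ⟩
    (+ suc m ℤ.* + D m ℤ.+ sign (suc m)) /! suc m  ≡⟨ cong (_/! suc m) (D-alternating m) ⟨
    + D (suc m) /! suc m                           ∎
    where open ≡-Reasoning

  expNeg⋆geom⋆geom : ∀ n → (expNeg ⋆ (geom ⋆ geom)) n ≡ + (D n + D (suc n)) /! n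
  expNeg⋆geom⋆geom zero    = cong₂ (λ d d′ → + (d + d′) /! 0) (sym D₀) (sym D₁)
  expNeg⋆geom⋆geom (suc n) = begin
    (expNeg ⋆ (geom ⋆ geom)) (suc n)
      ≡⟨ ⋆-geom⋆geom-suc expNeg n ⟩
    (expNeg ⋆ (geom ⋆ geom)) n ℚ.+ sumTo (suc n) expNeg
      ≡⟨ cong₂ ℚ._+_ (expNeg⋆geom⋆geom n) (sumTo-expNeg (suc n)) ⟩
    + (D n + D (suc n)) /! n ℚ.+ + D (suc n) /! suc n
      ≡⟨ +-common-denominator (+ (D n + D (suc n))) (+ D (suc n)) n (n !) {{n !≢0}} {{suc n !≢0}} ⟩
    (+ suc n ℤ.* + (D n + D (suc n)) ℤ.+ + D (suc n)) /! suc n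
      ≡⟨ cong (_/! suc n) numerator ⟩
    + (D (suc n) + D (2 + n)) /! suc n ∎
    where
    open ≡-Reasoning
    numerator : + suc n ℤ.* + (D n + D (suc n)) ℤ.+ + D (suc n) ≡ + (D (suc n) + D (2 + n))
    numerator = begin
      + suc n ℤ.* + (D n + D (suc n)) ℤ.+ + D (suc n)  ≡⟨ cong (ℤ._+ + D (suc n)) (pos-* (suc n) _) ⟨
      + (suc n * (D n + D (suc n))) ℤ.+ + D (suc n)    ≡⟨ pos-+ _ (D (suc n)) ⟨
      + (suc n * (D n + D (suc n)) + D (suc n))        ≡⟨ cong +_ (+-comm _ (D (suc n))) ⟩
      + (D (suc n) + suc n * (D n + D (suc n)))        ≡⟨ cong (λ t → + (D (suc n) + suc n * t)) (+-comm (D n) _) ⟩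
      + (D (suc n) + suc n * (D (suc n) + D n))        ≡⟨ cong (λ t → + (D (suc n) + t)) (D-rec n) ⟨
      + (D (suc n) + D (2 + n))                        ∎

partialDerangements-column-pascal : ∀ b k →
  partialDerangements (suc b + k) (suc b) ≡ partialDerangements (b + k) b + partialDerangements (b + suc k) b
partialDerangements-column-pascal b k = trans (partialDerangements-pascal (s≤s (m≤m+n b k)))
  (cong (λ N → partialDerangements (b + k) b + partialDerangements N b) (sym (+-suc b k)))

partialDerangements-column-head : ∀ b → partialDerangements (b + 0) b ≡ b !
partialDerangements-column-head b =
  trans (cong (λ N → partialDerangements N b) (+-identityʳ b)) (partialDerangements-diagonal b)

open PascalArray (λ b k → partialDerangements (b + k) b)
                 partialDerangements-column-pascal partialDerangements-column-head

derangements : ℕ → ℕ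
derangements n = partialDerangements n 0

derangements-recurrence : ∀ m → derangements (2 + m) ≡ suc m * (derangements (suc m) + derangements m)
derangements-recurrence m =
  trans (column-recurrence 0 (suc m)) (sym (*-distribˡ-+ (suc m) (derangements (suc m)) (derangements m)))

open DerangementSequence derangements (partialDerangements-column-head 0) (column-recurrence 0 0) derangements-recurrence

proposition3p5 : ∀ (n : ℕ) → egf (λ m → d (suc (suc m)) 1) n ≡ (expNeg ⋆ (geom ⋆ geom)) n
proposition3p5 n = begin
  + d (suc (suc n)) 1 /! n                        ≡⟨ cong (λ a → + a /! n) (d≡partialDerangements n) ⟩
  + partialDerangements (suc n) 1 /! n            ≡⟨ cong (λ a → + a /! n) (partialDerangements-column-pascal 0 n) ⟩
  + (derangements n + derangements (suc n)) /! n  ≡⟨ expNeg⋆geom⋆geom n ⟨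
  (expNeg ⋆ (geom ⋆ geom)) n                      ∎
  where open ≡-Reasoning
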